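{- Let $r\ge 3$ and let $t$ be a positive integer with $2^t\le 2^{r-1}-2$. Then $(2^t+1)\text{ - }\mathrm{gp_e}(C_{2^r}\,\square\, C_{2^r})=2^{r+t+1}$.
   Context: $C_n$ is the cycle on $n$ vertices and $\square$ denotes the Cartesian product of graphs (vertex set $V(G)\times V(H)$, with $(g,h)\sim(g',h')$ iff either $gg'\in E(G)$ and $h=h'$, or $g=g'$ and $hh'\in E(H)$). A geodesic is a shortest path. For an integer $k\ge3$, an edge $k$-general position set of a graph $G$ is a set $S\subseteq E(G)$ with $|S\cap E(P)|\le k-1$ for every geodesic $P$ of $G$; $k\text{ - }\mathrm{gp_e}(G)$ is the maximum cardinality of such a set. -}

module Defs where

open import Data.Nat using (ℕ; zero; suc; _+_; _∸_; _≤_)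
open import Data.Fin using (Fin; toℕ)
open import Data.Fin.Properties using () renaming (_≟_ to _≟Fin_)
open import Data.Product using (_×_; _,_; Σ-syntax)
open import Data.Product.Properties using (≡-dec)
open import Data.Sum using (_⊎_; inj₁; inj₂)
open import Data.List using (List; []; _∷_; length)
open import Data.List.Relation.Unary.All using (All)
open import Data.List.Relation.Unary.Any using (Any)
open import Data.List.Relation.Unary.Any using () renaming (any? to anyDec)
open import Data.List.Relation.Unary.AllPairs using (AllPairs)
open import Relation.Nullary using (¬_; Dec; yes; no)
open import Relation.Nullary.Decidable using (_×-dec_; _⊎-dec_)
open import Relation.Binary.PropositionalEquality using (_≡_)
open import Relation.Binary.Definitions using (DecidableEquality)

-- A (simple, undirected) graph: vertex type with decidable equality and
-- a symmetric adjacency relation (symmetry holds for the graphs below).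
record Graph : Set₁ where
  field
    V   : Set
    _≟V_ : DecidableEquality V
    Adj : V → V → Set

open Graph public

Cycle : ℕ → Graph
Cycle n = record
  { V = Fin n
  ; _≟V_ = _≟Fin_
  ; Adj = λ i j → (toℕ j ≡ suc (toℕ i)) ⊎ (toℕ i ≡ suc (toℕ j))
                 ⊎ ((toℕ i ≡ 0) × (suc (toℕ j) ≡ n))
                 ⊎ ((toℕ j ≡ 0) × (suc (toℕ i) ≡ n))
  }

_□_ : Graph → Graph → Graph
G □ H = record
  { V = V G × V H
  ; _≟V_ = ≡-dec (_≟V_ G) (_≟V_ H)
  ; Adj = λ { (g , h) (g' , h') →
              (Adj G g g' × h ≡ h') ⊎ (g ≡ g' × Adj H h h') }
  }

module _ (G : Graph) where
  private
    W = V G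
    _≟_ = _≟V_ G

  data Walk : W → W → Set where
    []  : ∀ {u} → Walk u u
    _∷_ : ∀ {u v w} → Adj G u v → Walk v w → Walk u w

  len : ∀ {u v} → Walk u v → ℕ
  len []      = 0
  len (_ ∷ p) = suc (len p)

  edgesOf : ∀ {u v} → Walk u v → List (W × W)
  edgesOf {u} (_∷_ {v = x} _ p) = (u , x) ∷ edgesOf p
  edgesOf []                    = []

  -- A geodesic: a u,v-walk of minimum length among all u,v-walks
  -- (such a walk is necessarily a path, so this is a shortest path).
  Geodesic : ∀ {u v} → Walk u v → Set
  Geodesic {u} {v} p = ∀ (q : Walk u v) → len p ≤ len q

  SameEdge : W × W → W × W → Set
  SameEdge (a , b) (c , d) = (a ≡ c × b ≡ d) ⊎ (a ≡ d × b ≡ c)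

  sameEdge? : ∀ e f → Dec (SameEdge e f)
  sameEdge? (a , b) (c , d) = ((a ≟ c) ×-dec (b ≟ d)) ⊎-dec ((a ≟ d) ×-dec (b ≟ c))

  -- A finite set of edges of G: a list of adjacent pairs with no edge
  -- listed twice (in either orientation). Its cardinality is its length.
  IsEdgeSet : List (W × W) → Set
  IsEdgeSet S = All (λ e → Adj G (Data.Product.proj₁ e) (Data.Product.proj₂ e)) S
              × AllPairs (λ e f → ¬ SameEdge e f) S

  countIn : List (W × W) → List (W × W) → ℕ
  countIn []      E = 0
  countIn (e ∷ S) E with anyDec (sameEdge? e) E
  ... | yes _ = suc (countIn S E)
  ... | no  _ = countIn S E

  IsEdgeGPSet : ℕ → List (W × W) → Set
  IsEdgeGPSet k S = IsEdgeSet S ×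
    (∀ {u v} (P : Walk u v) → Geodesic P → countIn S (edgesOf P) ≤ k ∸ 1)

  EdgeGPNumber : ℕ → ℕ → Set
  EdgeGPNumber k n =
    (Σ[ S ∈ List (W × W) ] (IsEdgeGPSet k S × length S ≡ n))
    × (∀ S → IsEdgeGPSet k S → length S ≤ n)

module Submission where

-- Put n = 2^r = 2h with h = T m, T = 2^t and m = 2^(r-1-t), so that k - 1 = T.
-- A geodesic of C_n □ C_n moves horizontally in one direction only and by at most h steps
-- (in each coordinate it realises the cyclic distance, which is at most h). Hence if we mark
-- every horizontal edge leaving a column divisible by m, a geodesic contains at most
-- ⌈(Z + h)/m⌉ - ⌈Z/m⌉ = T marked edges, where Z lifts its starting column to ℕ; there are
-- 2T·n marked edges. Conversely, the 2n diagonal staircases of length 2h starting in rows 0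
-- and h are geodesics covering every edge, so an edge k-general position set has at most
-- 2n(k-1) = 2^(r+t+1) edges.

open import Defs
open import Data.Bool using (Bool; true; false)
open import Data.Fin using (Fin; toℕ; fromℕ<)
open import Data.Fin.Properties using (toℕ-fromℕ<; toℕ-injective; toℕ<n)
open import Data.List using (List; []; _∷_; [_]; _++_; length; map; cartesianProduct; allFin)
open import Data.List.Membership.Propositional using (_∈_)
open import Data.List.Membership.Propositional.Properties using (∈-allFin; ∈-cartesianProduct⁺)
open import Data.List.Properties using (length-map; length-++; length-tabulate)
open import Data.List.Relation.Unary.All as All using (All; []; _∷_)
import Data.List.Relation.Unary.All.Properties as All
open import Data.List.Relation.Unary.AllPairs as AllPairs using (AllPairs; []; _∷_)
import Data.List.Relation.Unary.AllPairs.Properties as AllPairs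
open import Data.List.Relation.Unary.Any as Any using (Any; here; there)
import Data.List.Relation.Unary.Unique.Propositional.Properties as Unique
open import Data.Nat
open import Data.Nat.DivMod
open import Data.Nat.Divisibility using (divides; n∣m*n; _∣_)
open import Data.Nat.GeneralisedArithmetic using (iterate)
open import Data.Nat.ListAction using (sum)
open import Data.Nat.Properties
open import Algebra.Properties.CommutativeSemigroup +-commutativeSemigroup using (xy∙z≈xz∙y; xy∙z≈y∙xz)
open import Data.Nat.Tactic.RingSolver using (solve-∀)
open import Data.Product using (Σ; _×_; _,_; proj₁; proj₂)
open import Data.Sum using (_⊎_; inj₁; inj₂; [_,_]′)
open import Function using (_∘_)
open import Relation.Binary.Bundles using (Setoid)
import Relation.Binary.Construct.On as On
open import Relation.Binary.PropositionalEquality hiding ([_])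
import Relation.Binary.Reasoning.Setoid as SetoidReasoning
open import Relation.Nullary using (¬_; Dec; yes; no; contradiction)

length-cartesianProduct : ∀ {A B : Set} (xs : List A) (ys : List B) →
                          length (cartesianProduct xs ys) ≡ length xs * length ys
length-cartesianProduct []       ys = refl
length-cartesianProduct (x ∷ xs) ys = begin
  length (map (x ,_) ys ++ cartesianProduct xs ys)           ≡⟨ length-++ (map (x ,_) ys) ⟩
  length (map (x ,_) ys) + length (cartesianProduct xs ys)   ≡⟨ cong₂ _+_ (length-map (x ,_) ys) (length-cartesianProduct xs ys) ⟩
  length ys + length xs * length ys                          ∎
  where open ≡-Reasoning

length-allFin : ∀ k → length (allFin k) ≡ k
length-allFin k = length-tabulate (λ i → i)

module _ {I : Set} where

  sum-map-mono : ∀ (ws : List I) {f g : I → ℕ} → (∀ w → f w ≤ g w) → sum (map f ws) ≤ sum (map g ws)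
  sum-map-mono []       f≤g = z≤n
  sum-map-mono (w ∷ ws) f≤g = +-mono-≤ (f≤g w) (sum-map-mono ws f≤g)

  sum-map-mono-< : ∀ {ws : List I} {f g : I → ℕ} {w} → w ∈ ws → (∀ w → f w ≤ g w) → f w < g w →
                   sum (map f ws) < sum (map g ws)
  sum-map-mono-< {_ ∷ ws} (here refl) f≤g f<g = +-mono-<-≤ f<g (sum-map-mono ws f≤g)
  sum-map-mono-< {w ∷ _}  (there w∈) f≤g f<g = +-mono-≤-< (f≤g w) (sum-map-mono-< w∈ f≤g f<g)

  sum-map-≤-length* : ∀ (ws : List I) {f : I → ℕ} {c} → (∀ w → f w ≤ c) → sum (map f ws) ≤ length ws * c
  sum-map-≤-length* []       f≤c = z≤n
  sum-map-≤-length* (w ∷ ws) f≤c = +-mono-≤ (f≤c w) (sum-map-≤-length* ws f≤c)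

module Congruence (n : ℕ) {{_ : NonZero n}} where

  ≈-setoid : Setoid _ _
  ≈-setoid = On.setoid (setoid ℕ) (_% n)

  open Setoid ≈-setoid public using (_≈_)
  module ≈-Reasoning = SetoidReasoning ≈-setoid

  %-≈ : ∀ a → a % n ≈ a
  %-≈ a = m%n%n≡m%n a n

  +n-≈ : ∀ a → a + n ≈ a
  +n-≈ a = [m+n]%n≡m%n a n

  +-congʳ-≈ : ∀ {a b} c → a ≈ b → a + c ≈ b + c
  +-congʳ-≈ {a} {b} c a≈b = begin
    (a + c) % n           ≡⟨ %-distribˡ-+ a c n ⟩
    (a % n + c % n) % n   ≡⟨ cong (λ z → (z + c % n) % n) a≈b ⟩
    (b % n + c % n) % n   ≡⟨ %-distribˡ-+ b c n ⟨
    (b + c) % n           ∎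
    where open ≡-Reasoning

  +-congˡ-≈ : ∀ {a b} c → a ≈ b → c + a ≈ c + b
  +-congˡ-≈ {a} {b} c a≈b = subst₂ _≈_ (+-comm a c) (+-comm b c) (+-congʳ-≈ c a≈b)

  +-cancelʳ-≈ : ∀ {a b} c → a + c ≈ b + c → a ≈ b
  +-cancelʳ-≈ {a} {b} c eq = begin
    a                ≈⟨ +n-≈ a ⟨
    a + n            ≈⟨ +-congˡ-≈ a c+c̄≈n ⟨
    a + (c + c̄)      ≡⟨ +-assoc a c c̄ ⟨
    a + c + c̄        ≈⟨ +-congʳ-≈ c̄ eq ⟩
    b + c + c̄        ≡⟨ +-assoc b c c̄ ⟩
    b + (c + c̄)      ≈⟨ +-congˡ-≈ b c+c̄≈n ⟩
    b + n            ≈⟨ +n-≈ b ⟩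
    b                ∎
    where
    open ≈-Reasoning
    c̄ : ℕ
    c̄ = n ∸ c % n
    c+c̄≈n : c + c̄ ≈ n
    c+c̄≈n = begin
      c + c̄          ≈⟨ +-congʳ-≈ c̄ (%-≈ c) ⟨
      c % n + c̄      ≡⟨ m+[n∸m]≡n (m%n≤n c n) ⟩
      n              ∎

  suc-cancel-≈ : ∀ {a b} → suc a ≈ suc b → a ≈ b
  suc-cancel-≈ {a} {b} eq = +-cancelʳ-≈ 1 (subst₂ _≈_ (+-comm 1 a) (+-comm 1 b) eq)

  toℕ-≈-injective : ∀ {x y : Fin n} → toℕ x ≈ toℕ y → x ≡ y
  toℕ-≈-injective {x} {y} eq =
    toℕ-injective (trans (sym (m<n⇒m%n≡m (toℕ<n x))) (trans eq (m<n⇒m%n≡m (toℕ<n y))))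

module Walks (G : Graph) where

  infixr 5 _++ᵂ_

  _++ᵂ_ : ∀ {u v w} → Walk G u v → Walk G v w → Walk G u w
  []      ++ᵂ q = q
  (a ∷ p) ++ᵂ q = a ∷ (p ++ᵂ q)

  len-++ᵂ : ∀ {u v w} (p : Walk G u v) (q : Walk G v w) → len G (p ++ᵂ q) ≡ len G p + len G q
  len-++ᵂ []      q = refl
  len-++ᵂ (a ∷ p) q = cong suc (len-++ᵂ p q)

  len-subst : ∀ {u v w} (e : v ≡ w) (p : Walk G u v) → len G (subst (Walk G u) e p) ≡ len G p
  len-subst refl p = refl

  module _ (Adj-sym : ∀ {u v} → Adj G u v → Adj G v u) where

    reverseᵂ : ∀ {u v} → Walk G u v → Walk G v u
    reverseᵂ []      = []
    reverseᵂ (a ∷ p) = reverseᵂ p ++ᵂ (Adj-sym a ∷ [])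

    len-reverseᵂ : ∀ {u v} (p : Walk G u v) → len G (reverseᵂ p) ≡ len G p
    len-reverseᵂ []      = refl
    len-reverseᵂ (a ∷ p) = begin
      len G (reverseᵂ p ++ᵂ (Adj-sym a ∷ []))  ≡⟨ len-++ᵂ (reverseᵂ p) _ ⟩
      len G (reverseᵂ p) + 1                   ≡⟨ cong (_+ 1) (len-reverseᵂ p) ⟩
      len G p + 1                              ≡⟨ +-comm (len G p) 1 ⟩
      suc (len G p)                            ∎
      where open ≡-Reasoning

module _ (G : Graph) (H : Graph) where

  □-liftˡ : ∀ {a b} y → Walk G a b → Walk (G □ H) (a , y) (b , y)
  □-liftˡ y []      = []
  □-liftˡ y (a ∷ p) = inj₁ (a , refl) ∷ □-liftˡ y p

  □-liftʳ : ∀ x {a b} → Walk H a b → Walk (G □ H) (x , a) (x , b)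
  □-liftʳ x []      = []
  □-liftʳ x (a ∷ p) = inj₂ (refl , a) ∷ □-liftʳ x p

  len-□-liftˡ : ∀ {a b} y (p : Walk G a b) → len (G □ H) (□-liftˡ y p) ≡ len G p
  len-□-liftˡ y []      = refl
  len-□-liftˡ y (a ∷ p) = cong suc (len-□-liftˡ y p)

  len-□-liftʳ : ∀ x {a b} (p : Walk H a b) → len (G □ H) (□-liftʳ x p) ≡ len H p
  len-□-liftʳ x []      = refl
  len-□-liftʳ x (a ∷ p) = cong suc (len-□-liftʳ x p)

module Counting (G : Graph) where

  private
    E = V G × V G

    ¬here : ∀ {e f : E} → ¬ SameEdge G e f → ¬ Any (SameEdge G e) [ f ]
    ¬here ¬s (here s) = ¬s s

  SameEdge-sym : ∀ {e f : E} → SameEdge G e f → SameEdge G f e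
  SameEdge-sym (inj₁ (refl , refl)) = inj₁ (refl , refl)
  SameEdge-sym (inj₂ (refl , refl)) = inj₂ (refl , refl)

  SameEdge-trans : ∀ {e f g : E} → SameEdge G e f → SameEdge G f g → SameEdge G e g
  SameEdge-trans (inj₁ (refl , refl)) s = s
  SameEdge-trans (inj₂ (refl , refl)) (inj₁ (refl , refl)) = inj₂ (refl , refl)
  SameEdge-trans (inj₂ (refl , refl)) (inj₂ (refl , refl)) = inj₁ (refl , refl)

  countIn-∷-hit : ∀ e S F → Any (SameEdge G e) F → countIn G (e ∷ S) F ≡ suc (countIn G S F)
  countIn-∷-hit e S F hit with Any.any? (sameEdge? G e) F
  ... | yes _   = refl
  ... | no miss = contradiction hit miss

  countIn-∷-miss : ∀ e S F → ¬ Any (SameEdge G e) F → countIn G (e ∷ S) F ≡ countIn G S F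
  countIn-∷-miss e S F miss with Any.any? (sameEdge? G e) F
  ... | yes hit = contradiction hit miss
  ... | no _    = refl

  countIn-∷-≤ : ∀ e S F → countIn G S F ≤ countIn G (e ∷ S) F
  countIn-∷-≤ e S F with Any.any? (sameEdge? G e) F
  ... | yes _ = n≤1+n _
  ... | no _  = ≤-refl

  countIn-[]ʳ : ∀ S → countIn G S [] ≡ 0
  countIn-[]ʳ []      = refl
  countIn-[]ʳ (e ∷ S) = trans (countIn-∷-miss e S [] λ ()) (countIn-[]ʳ S)

  countIn-∷ʳ : ∀ S f F → countIn G S (f ∷ F) ≤ countIn G S [ f ] + countIn G S F
  countIn-∷ʳ []      f F = z≤n
  countIn-∷ʳ (e ∷ S) f F = by-cases (sameEdge? G e f) (Any.any? (sameEdge? G e) F)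
    where
    open ≤-Reasoning
    by-cases : Dec (SameEdge G e f) → Dec (Any (SameEdge G e) F) →
               countIn G (e ∷ S) (f ∷ F) ≤ countIn G (e ∷ S) [ f ] + countIn G (e ∷ S) F
    by-cases (yes s) _ = begin
      countIn G (e ∷ S) (f ∷ F)                        ≡⟨ countIn-∷-hit e S _ (here s) ⟩
      suc (countIn G S (f ∷ F))                        ≤⟨ s≤s (countIn-∷ʳ S f F) ⟩
      suc (countIn G S [ f ] + countIn G S F)          ≤⟨ s≤s (+-monoʳ-≤ _ (countIn-∷-≤ e S F)) ⟩
      suc (countIn G S [ f ] + countIn G (e ∷ S) F)    ≡⟨ cong (_+ _) (countIn-∷-hit e S _ (here s)) ⟨
      countIn G (e ∷ S) [ f ] + countIn G (e ∷ S) F    ∎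
    by-cases (no ¬s) (yes hit) = begin
      countIn G (e ∷ S) (f ∷ F)                        ≡⟨ countIn-∷-hit e S _ (there hit) ⟩
      suc (countIn G S (f ∷ F))                        ≤⟨ s≤s (countIn-∷ʳ S f F) ⟩
      suc (countIn G S [ f ] + countIn G S F)          ≡⟨ +-suc _ _ ⟨
      countIn G S [ f ] + suc (countIn G S F)          ≡⟨ cong₂ _+_ (countIn-∷-miss e S _ (¬here ¬s)) (countIn-∷-hit e S F hit) ⟨
      countIn G (e ∷ S) [ f ] + countIn G (e ∷ S) F    ∎
    by-cases (no ¬s) (no miss) = begin
      countIn G (e ∷ S) (f ∷ F)                        ≡⟨ countIn-∷-miss e S _ (λ { (here s) → ¬s s ; (there hit) → miss hit }) ⟩
      countIn G S (f ∷ F)                              ≤⟨ countIn-∷ʳ S f F ⟩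
      countIn G S [ f ] + countIn G S F                ≡⟨ cong₂ _+_ (countIn-∷-miss e S _ (¬here ¬s)) (countIn-∷-miss e S F miss) ⟨
      countIn G (e ∷ S) [ f ] + countIn G (e ∷ S) F    ∎

  countIn-[-]≡0 : ∀ S f → All (λ e → ¬ SameEdge G e f) S → countIn G S [ f ] ≡ 0
  countIn-[-]≡0 []      f []          = refl
  countIn-[-]≡0 (e ∷ S) f (¬s ∷ ¬ss) = trans (countIn-∷-miss e S _ (¬here ¬s)) (countIn-[-]≡0 S f ¬ss)

  countIn-[-]≤1 : ∀ S f → AllPairs (λ e e' → ¬ SameEdge G e e') S → countIn G S [ f ] ≤ 1
  countIn-[-]≤1 []      f _ = z≤n
  countIn-[-]≤1 (e ∷ S) f (distinct ∷ distinctS) = by-cases (sameEdge? G e f)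
    where
    others : SameEdge G e f → ∀ {S'} → All (λ e' → ¬ SameEdge G e e') S' → All (λ e' → ¬ SameEdge G e' f) S'
    others s []           = []
    others s (¬s' ∷ ¬ss') = (λ s' → ¬s' (SameEdge-trans s (SameEdge-sym s'))) ∷ others s ¬ss'
    by-cases : Dec (SameEdge G e f) → countIn G (e ∷ S) [ f ] ≤ 1
    by-cases (yes s) = ≤-reflexive (trans (countIn-∷-hit e S _ (here s)) (cong suc (countIn-[-]≡0 S f (others s distinct))))
    by-cases (no ¬s) = ≤-trans (≤-reflexive (countIn-∷-miss e S _ (¬here ¬s))) (countIn-[-]≤1 S f distinctS)

  length-≤-sum-countIn : ∀ {I : Set} (ws : List I) (F : I → List E) →
    (∀ e → Adj G (proj₁ e) (proj₂ e) → Σ I λ w → w ∈ ws × Any (SameEdge G e) (F w)) →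
    ∀ S → All (λ e → Adj G (proj₁ e) (proj₂ e)) S → length S ≤ sum (map (λ w → countIn G S (F w)) ws)
  length-≤-sum-countIn ws F cover []      _            = z≤n
  length-≤-sum-countIn ws F cover (e ∷ S) (adj ∷ adjs) with cover e adj
  ... | w , w∈ws , hit = ≤-trans (s≤s (length-≤-sum-countIn ws F cover S adjs))
      (sum-map-mono-< w∈ws (λ w' → countIn-∷-≤ e S (F w')) (≤-reflexive (sym (countIn-∷-hit e S (F w) hit))))

module CycleGeometry (n : ℕ) {{_ : NonZero n}} where

  open Congruence n public

  C : Graph
  C = Cycle n

  next : Fin n → Fin n
  next x = fromℕ< (m%n<n (suc (toℕ x)) n)

  toℕ-next : ∀ x → toℕ (next x) ≈ suc (toℕ x)
  toℕ-next x = trans (cong (_% n) (toℕ-fromℕ< _)) (%-≈ _)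

  toℕ-next^ : ∀ k x → toℕ (iterate next x k) ≈ toℕ x + k
  toℕ-next^ zero    x = cong (_% n) (sym (+-identityʳ (toℕ x)))
  toℕ-next^ (suc k) x = begin
    toℕ (iterate next (next x) k)   ≈⟨ toℕ-next^ k (next x) ⟩
    toℕ (next x) + k                ≈⟨ +-congʳ-≈ k (toℕ-next x) ⟩
    suc (toℕ x) + k                 ≡⟨ +-suc (toℕ x) k ⟨
    toℕ x + suc k                   ∎
    where open ≈-Reasoning

  next-< : ∀ x → suc (toℕ x) < n → toℕ (next x) ≡ suc (toℕ x)
  next-< x lt = trans (toℕ-fromℕ< _) (m<n⇒m%n≡m lt)

  next-last : ∀ x → suc (toℕ x) ≡ n → toℕ (next x) ≡ 0
  next-last x last = trans (toℕ-fromℕ< _) (trans (cong (_% n) last) (n%n≡0 n))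

  adj-next : ∀ x → Adj C x (next x)
  adj-next x with suc (toℕ x) <? n
  ... | yes lt = inj₁ (next-< x lt)
  ... | no ¬lt = inj₂ (inj₂ (inj₂ (next-last x last , last)))
    where last = ≤-antisym (toℕ<n x) (≮⇒≥ ¬lt)

  adj⇒next : ∀ {x y} → Adj C x y → y ≡ next x ⊎ x ≡ next y
  adj⇒next {x} {y} (inj₁ e) =
    inj₁ (toℕ-injective (trans e (sym (next-< x (subst (_< n) e (toℕ<n y))))))
  adj⇒next {x} {y} (inj₂ (inj₁ e)) =
    inj₂ (toℕ-injective (trans e (sym (next-< y (subst (_< n) e (toℕ<n x))))))
  adj⇒next {x} {y} (inj₂ (inj₂ (inj₁ (x≡0 , last)))) = inj₂ (toℕ-injective (trans x≡0 (sym (next-last y last))))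
  adj⇒next {x} {y} (inj₂ (inj₂ (inj₂ (y≡0 , last)))) = inj₁ (toℕ-injective (trans y≡0 (sym (next-last x last))))

  Adj-sym : ∀ {x y} → Adj C x y → Adj C y x
  Adj-sym (inj₁ e)                  = inj₂ (inj₁ e)
  Adj-sym (inj₂ (inj₁ e))           = inj₁ e
  Adj-sym (inj₂ (inj₂ (inj₁ p)))    = inj₂ (inj₂ (inj₂ p))
  Adj-sym (inj₂ (inj₂ (inj₂ p)))    = inj₂ (inj₂ (inj₁ p))

  next^-≢ : ∀ {k} → 0 < k → k < n → ∀ x → iterate next x k ≢ x
  next^-≢ {k} 0<k k<n x eq = <⇒≢ 0<k (sym k≡0)
    where
    k≈0 : k ≈ 0
    k≈0 = +-cancelʳ-≈ (toℕ x) (begin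
      k + toℕ x                ≡⟨ +-comm k (toℕ x) ⟩
      toℕ x + k                ≈⟨ toℕ-next^ k x ⟨
      toℕ (iterate next x k)   ≡⟨ cong toℕ eq ⟩
      toℕ x                    ∎)
      where open ≈-Reasoning
    k≡0 : k ≡ 0
    k≡0 = trans (sym (m<n⇒m%n≡m k<n)) (trans k≈0 (m<n⇒m%n≡m (>-nonZero⁻¹ n)))

  isForward isBackward : ∀ {x y} → y ≡ next x ⊎ x ≡ next y → ℕ
  isForward  (inj₁ _) = 1
  isForward  (inj₂ _) = 0
  isBackward (inj₁ _) = 0
  isBackward (inj₂ _) = 1

  step-≈ : ∀ {x y} (d : y ≡ next x ⊎ x ≡ next y) {r l w} →
           toℕ y + r ≈ w + l → toℕ x + (isForward d + r) ≈ w + (isBackward d + l)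
  step-≈ {x} (inj₁ refl) {r} {l} {w} eq = begin
    toℕ x + suc r          ≡⟨ +-suc (toℕ x) r ⟩
    suc (toℕ x) + r        ≈⟨ +-congʳ-≈ r (toℕ-next x) ⟨
    toℕ (next x) + r       ≈⟨ eq ⟩
    w + l                  ∎
    where open ≈-Reasoning
  step-≈ {y = y} (inj₂ refl) {r} {l} {w} eq = begin
    toℕ (next y) + r       ≈⟨ +-congʳ-≈ r (toℕ-next y) ⟩
    suc (toℕ y + r)        ≈⟨ +-congˡ-≈ 1 eq ⟩
    suc (w + l)            ≡⟨ +-suc w l ⟨
    w + suc l              ∎
    where open ≈-Reasoning

  offset : Fin n → Fin n → ℕ
  offset x y = (n + toℕ y ∸ toℕ x) % n

  offset-≈ : ∀ x y → toℕ x + offset x y ≈ toℕ y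
  offset-≈ x y = begin
    toℕ x + (n + toℕ y ∸ toℕ x) % n   ≈⟨ +-congˡ-≈ (toℕ x) (%-≈ _) ⟩
    toℕ x + (n + toℕ y ∸ toℕ x)       ≡⟨ m+[n∸m]≡n (≤-trans (<⇒≤ (toℕ<n x)) (m≤m+n n (toℕ y))) ⟩
    n + toℕ y                         ≡⟨ +-comm n (toℕ y) ⟩
    toℕ y + n                         ≈⟨ +n-≈ (toℕ y) ⟩
    toℕ y                             ∎
    where open ≈-Reasoning

  offset-≡ : ∀ x y d → toℕ x + d ≈ toℕ y → offset x y ≡ d % n
  offset-≡ x y d eq = trans (sym (%-≈ (n + toℕ y ∸ toℕ x))) (+-cancelʳ-≈ (toℕ x) (begin
    offset x y + toℕ x    ≡⟨ +-comm (offset x y) (toℕ x) ⟩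
    toℕ x + offset x y    ≈⟨ offset-≈ x y ⟩
    toℕ y                 ≈⟨ eq ⟨
    toℕ x + d             ≡⟨ +-comm (toℕ x) d ⟩
    d + toℕ x             ∎))
    where open ≈-Reasoning

  offset-≤ : ∀ x y d → toℕ x + d ≈ toℕ y → offset x y ≤ d
  offset-≤ x y d eq = ≤-trans (≤-reflexive (offset-≡ x y d eq)) (m%n≤m d n)

  offset-≤-∸ : ∀ x y → offset y x ≤ n ∸ offset x y
  offset-≤-∸ x y = offset-≤ y x (n ∸ o) (begin
    toℕ y + (n ∸ o)          ≈⟨ +-congʳ-≈ (n ∸ o) (offset-≈ x y) ⟨
    toℕ x + o + (n ∸ o)      ≡⟨ +-assoc (toℕ x) o (n ∸ o) ⟩
    toℕ x + (o + (n ∸ o))    ≡⟨ cong (toℕ x +_) (m+[n∸m]≡n (m%n≤n _ n)) ⟩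
    toℕ x + n                ≈⟨ +n-≈ (toℕ x) ⟩
    toℕ x                    ∎)
    where
    open ≈-Reasoning
    o : ℕ
    o = offset x y

  dist : Fin n → Fin n → ℕ
  dist x y = offset x y ⊓ offset y x

  dist-comm : ∀ x y → dist x y ≡ dist y x
  dist-comm x y = ⊓-comm (offset x y) (offset y x)

  dist-≤-∸ : ∀ x y {p q} → toℕ x + p ≈ toℕ y + q → q ≤ p → dist x y ≤ p ∸ q
  dist-≤-∸ x y {p} {q} eq q≤p = ≤-trans (m⊓n≤m _ _) (offset-≤ x y (p ∸ q) (+-cancelʳ-≈ q (begin
    toℕ x + (p ∸ q) + q      ≡⟨ +-assoc (toℕ x) (p ∸ q) q ⟩
    toℕ x + (p ∸ q + q)      ≡⟨ cong (toℕ x +_) (m∸n+n≡m q≤p) ⟩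
    toℕ x + p                ≈⟨ eq ⟩
    toℕ y + q                ∎)))
    where open ≈-Reasoning

  dist-≤-steps : ∀ x y {p q} → toℕ x + p ≈ toℕ y + q → dist x y ≤ p + q
  dist-≤-steps x y {p} {q} eq with ≤-total q p
  ... | inj₁ q≤p = ≤-trans (dist-≤-∸ x y eq q≤p) (≤-trans (m∸n≤m p q) (m≤m+n p q))
  ... | inj₂ p≤q = begin
    dist x y       ≡⟨ dist-comm x y ⟩
    dist y x       ≤⟨ dist-≤-∸ y x (sym eq) p≤q ⟩
    q ∸ p          ≤⟨ m∸n≤m q p ⟩
    q              ≤⟨ m≤n+m q p ⟩
    p + q          ∎
    where open ≤-Reasoning

  dist-≥-steps : ∀ x y {p q} → toℕ x + p ≈ toℕ y + q → p + q ≤ dist x y → q ≡ 0 ⊎ p ≡ 0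
  dist-≥-steps x y {p} {q} eq tight with ≤-total q p
  ... | inj₁ q≤p = inj₁ (n≤0⇒n≡0 (+-cancelˡ-≤ p q 0 (begin
    p + q          ≤⟨ tight ⟩
    dist x y       ≤⟨ dist-≤-∸ x y eq q≤p ⟩
    p ∸ q          ≤⟨ m∸n≤m p q ⟩
    p              ≡⟨ +-identityʳ p ⟨
    p + 0          ∎)))
    where open ≤-Reasoning
  ... | inj₂ p≤q = inj₂ (n≤0⇒n≡0 (+-cancelʳ-≤ q p 0 (begin
    p + q          ≤⟨ tight ⟩
    dist x y       ≡⟨ dist-comm x y ⟩
    dist y x       ≤⟨ dist-≤-∸ y x (sym eq) p≤q ⟩
    q ∸ p          ≤⟨ m∸n≤m q p ⟩
    q              ∎)))
    where open ≤-Reasoning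

  next^-surjective : ∀ {k} → k ≤ n → ∀ x → Σ (Fin n) λ a → iterate next a k ≡ x
  next^-surjective {k} k≤n x = a , toℕ-≈-injective (begin
    toℕ (iterate next a k)       ≈⟨ toℕ-next^ k a ⟩
    toℕ a + k                    ≈⟨ +-congʳ-≈ k (toℕ-next^ (n ∸ k) x) ⟩
    toℕ x + (n ∸ k) + k          ≡⟨ +-assoc (toℕ x) (n ∸ k) k ⟩
    toℕ x + (n ∸ k + k)          ≡⟨ cong (toℕ x +_) (m∸n+n≡m k≤n) ⟩
    toℕ x + n                    ≈⟨ +n-≈ (toℕ x) ⟩
    toℕ x                        ∎)
    where
    open ≈-Reasoning
    a : Fin n
    a = iterate next x (n ∸ k)

  open Walks C

  forwardWalk : ∀ k x → Walk C x (iterate next x k)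
  forwardWalk zero    x = []
  forwardWalk (suc k) x = adj-next x ∷ forwardWalk k (next x)

  len-forwardWalk : ∀ k x → len C (forwardWalk k x) ≡ k
  len-forwardWalk zero    x = refl
  len-forwardWalk (suc k) x = cong suc (len-forwardWalk k (next x))

  next^-offset : ∀ x y → iterate next x (offset x y) ≡ y
  next^-offset x y = toℕ-≈-injective (trans (toℕ-next^ (offset x y) x) (offset-≈ x y))

  walkAlong : ∀ x y → Σ (Walk C x y) λ p → len C p ≡ offset x y
  walkAlong x y = subst (Walk C x) (next^-offset x y) (forwardWalk (offset x y) x)
                , trans (len-subst (next^-offset x y) _) (len-forwardWalk (offset x y) x)

  shortestWalk : ∀ x y → Σ (Walk C x y) λ p → len C p ≡ dist x y
  shortestWalk x y with offset x y ≤? offset y x | walkAlong x y | walkAlong y x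
  ... | yes ≤ | p , len-p | _ = p , trans len-p (sym (m≤n⇒m⊓n≡m ≤))
  ... | no ≰ | _ | q , len-q =
    reverseᵂ Adj-sym q , trans (len-reverseᵂ Adj-sym q) (trans len-q (sym (m≥n⇒m⊓n≡n (<⇒≤ (≰⇒> ≰)))))

module Torus (h : ℕ) (2≤h : 2 ≤ h) where

  n : ℕ
  n = h + h

  h<n : h < n
  h<n = m<m+n h (≤-trans (s≤s z≤n) 2≤h)

  2<n : 2 < n
  2<n = ≤-trans (s≤s 2≤h) h<n

  1<n : 1 < n
  1<n = <⇒≤ 2<n

  instance
    n-nonZero : NonZero n
    n-nonZero = >-nonZero (≤-trans (s≤s z≤n) h<n)

  open CycleGeometry n public

  G : Graph
  G = C □ C

  open Walks G public
  open Counting G public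

  dist-≤-h : ∀ x y → dist x y ≤ h
  dist-≤-h x y with offset x y ≤? h
  ... | yes ≤h = ≤-trans (m⊓n≤m _ _) ≤h
  ... | no ≰h = begin
    dist x y             ≤⟨ m⊓n≤n _ _ ⟩
    offset y x           ≤⟨ offset-≤-∸ x y ⟩
    n ∸ offset x y       ≤⟨ ∸-monoʳ-≤ n (<⇒≤ (≰⇒> ≰h)) ⟩
    n ∸ h                ≡⟨ m+n∸m≡n h h ⟩
    h                    ∎
    where open ≤-Reasoning

  right left up down : ∀ {u v} → Walk G u v → ℕ
  right []                  = 0
  right (inj₁ (a , _) ∷ p)  = isForward (adj⇒next a) + right p
  right (inj₂ _ ∷ p)        = right p
  left []                   = 0
  left (inj₁ (a , _) ∷ p)   = isBackward (adj⇒next a) + left p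
  left (inj₂ _ ∷ p)         = left p
  up []                     = 0
  up (inj₁ _ ∷ p)           = up p
  up (inj₂ (_ , a) ∷ p)     = isForward (adj⇒next a) + up p
  down []                   = 0
  down (inj₁ _ ∷ p)         = down p
  down (inj₂ (_ , a) ∷ p)   = isBackward (adj⇒next a) + down p

  len-steps : ∀ {u v} (P : Walk G u v) → len G P ≡ (right P + left P) + (up P + down P)
  len-steps [] = refl
  len-steps (inj₁ (a , _) ∷ p) with adj⇒next a
  ... | inj₁ _ = cong suc (len-steps p)
  ... | inj₂ _ = trans (cong suc (len-steps p)) (cong (_+ (up p + down p)) (sym (+-suc (right p) (left p))))
  len-steps (inj₂ (_ , a) ∷ p) with adj⇒next a
  ... | inj₁ _ = trans (cong suc (len-steps p)) (sym (+-suc (right p + left p) (up p + down p)))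
  ... | inj₂ _ = trans (cong suc (len-steps p))
                   (trans (sym (+-suc (right p + left p) (up p + down p)))
                          (cong ((right p + left p) +_) (sym (+-suc (up p) (down p)))))

  x-steps : ∀ {ux uy vx vy} (P : Walk G (ux , uy) (vx , vy)) → toℕ ux + right P ≈ toℕ vx + left P
  x-steps []                              = cong (_% n) (trans (+-identityʳ _) (sym (+-identityʳ _)))
  x-steps {vx = vx} (inj₁ (a , refl) ∷ p) = step-≈ (adj⇒next a) {w = toℕ vx} (x-steps p)
  x-steps (inj₂ (refl , _) ∷ p)           = x-steps p

  y-steps : ∀ {ux uy vx vy} (P : Walk G (ux , uy) (vx , vy)) → toℕ uy + up P ≈ toℕ vy + down P
  y-steps []                              = cong (_% n) (trans (+-identityʳ _) (sym (+-identityʳ _)))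
  y-steps (inj₁ (_ , refl) ∷ p)           = y-steps p
  y-steps {vy = vy} (inj₂ (refl , a) ∷ p) = step-≈ (adj⇒next a) {w = toℕ vy} (y-steps p)

  dist-≤-len : ∀ {ux uy vx vy} (P : Walk G (ux , uy) (vx , vy)) → dist ux vx + dist uy vy ≤ len G P
  dist-≤-len {ux} {uy} {vx} {vy} P = begin
    dist ux vx + dist uy vy                 ≤⟨ +-mono-≤ (dist-≤-steps ux vx (x-steps P)) (dist-≤-steps uy vy (y-steps P)) ⟩
    (right P + left P) + (up P + down P)    ≡⟨ len-steps P ⟨
    len G P                                 ∎
    where open ≤-Reasoning

  shortestWalkᴳ : ∀ ux uy vx vy → Σ (Walk G (ux , uy) (vx , vy)) λ P → len G P ≡ dist ux vx + dist uy vy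
  shortestWalkᴳ ux uy vx vy with shortestWalk ux vx | shortestWalk uy vy
  ... | p , len-p | q , len-q = □-liftˡ C C uy p ++ᵂ □-liftʳ C C vx q , (begin
    len G (□-liftˡ C C uy p ++ᵂ □-liftʳ C C vx q)         ≡⟨ len-++ᵂ (□-liftˡ C C uy p) _ ⟩
    len G (□-liftˡ C C uy p) + len G (□-liftʳ C C vx q)   ≡⟨ cong₂ _+_ (len-□-liftˡ C C uy p) (len-□-liftʳ C C vx q) ⟩
    len C p + len C q                                    ≡⟨ cong₂ _+_ len-p len-q ⟩
    dist ux vx + dist uy vy                              ∎)
    where open ≡-Reasoning

  geodesic-horizontal : ∀ {ux uy vx vy} (P : Walk G (ux , uy) (vx , vy)) → Geodesic G P →
                        right P + left P ≤ dist ux vx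
  geodesic-horizontal {ux} {uy} {vx} {vy} P geo = +-cancelʳ-≤ (up P + down P) _ _ (begin
    (right P + left P) + (up P + down P)   ≡⟨ len-steps P ⟨
    len G P                                ≤⟨ geo (proj₁ (shortestWalkᴳ ux uy vx vy)) ⟩
    len G (proj₁ (shortestWalkᴳ ux uy vx vy)) ≡⟨ proj₂ (shortestWalkᴳ ux uy vx vy) ⟩
    dist ux vx + dist uy vy                ≤⟨ +-monoʳ-≤ (dist ux vx) (dist-≤-steps uy vy (y-steps P)) ⟩
    dist ux vx + (up P + down P)           ∎)
    where open ≤-Reasoning

  geodesic-monotone : ∀ {ux uy vx vy} (P : Walk G (ux , uy) (vx , vy)) → Geodesic G P →
                      left P ≡ 0 ⊎ right P ≡ 0
  geodesic-monotone {ux} {vx = vx} P geo = dist-≥-steps ux vx (x-steps P) (geodesic-horizontal P geo)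

  geodesic-horizontal-≤h : ∀ {ux uy vx vy} (P : Walk G (ux , uy) (vx , vy)) → Geodesic G P →
                           right P + left P ≤ h
  geodesic-horizontal-≤h {ux} {vx = vx} P geo = ≤-trans (geodesic-horizontal P geo) (dist-≤-h ux vx)

  stair : ∀ k a c → Walk G (a , c) (iterate next a k , iterate next c k)
  stair zero    a c = []
  stair (suc k) a c = inj₁ (adj-next a , refl) ∷ inj₂ (refl , adj-next c) ∷ stair k (next a) (next c)

  len-stair : ∀ k a c → len G (stair k a c) ≡ k + k
  len-stair zero    a c = refl
  len-stair (suc k) a c = cong suc (trans (cong suc (len-stair k (next a) (next c))) (sym (+-suc k k)))

  toℕ-next^h+h : ∀ a → toℕ (iterate next a h) + h ≈ toℕ a
  toℕ-next^h+h a = begin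
    toℕ (iterate next a h) + h    ≈⟨ +-congʳ-≈ h (toℕ-next^ h a) ⟩
    toℕ a + h + h                 ≡⟨ +-assoc (toℕ a) h h ⟩
    toℕ a + n                     ≈⟨ +n-≈ (toℕ a) ⟩
    toℕ a                         ∎
    where open ≈-Reasoning

  dist-next^h : ∀ a → dist a (iterate next a h) ≡ h
  dist-next^h a = begin
    offset a b ⊓ offset b a     ≡⟨ cong₂ _⊓_ (offset-≡h (sym (toℕ-next^ h a))) (offset-≡h (toℕ-next^h+h a)) ⟩
    h ⊓ h                       ≡⟨ ⊓-idem h ⟩
    h                           ∎
    where
    open ≡-Reasoning
    b : Fin n
    b = iterate next a h
    offset-≡h : ∀ {x y} → toℕ x + h ≈ toℕ y → offset x y ≡ h
    offset-≡h {x} {y} eq = trans (offset-≡ x y h eq) (m<n⇒m%n≡m h<n)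

  stair-geodesic : ∀ a c → Geodesic G (stair h a c)
  stair-geodesic a c Q = begin
    len G (stair h a c)                                        ≡⟨ len-stair h a c ⟩
    h + h                                                      ≡⟨ cong₂ _+_ (dist-next^h a) (dist-next^h c) ⟨
    dist a (iterate next a h) + dist c (iterate next c h)      ≤⟨ dist-≤-len Q ⟩
    len G Q                                                    ∎
    where open ≤-Reasoning

  stair-right : ∀ {i k} → i < k → ∀ a c →
    Any (SameEdge G ((iterate next a i , iterate next c i) , (next (iterate next a i) , iterate next c i)))
        (edgesOf G (stair k a c))
  stair-right {zero}  (s≤s _)   a c = here (inj₁ (refl , refl))
  stair-right {suc i} (s≤s i<k) a c = there (there (stair-right i<k (next a) (next c)))

  stair-up : ∀ {i k} → i < k → ∀ a c →
    Any (SameEdge G ((iterate next a (suc i) , iterate next c i) , (iterate next a (suc i) , next (iterate next c i))))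
        (edgesOf G (stair k a c))
  stair-up {zero}  (s≤s _)   a c = there (here (inj₁ (refl , refl)))
  stair-up {suc i} (s≤s i<k) a c = there (there (stair-up i<k (next a) (next c)))

  rowStart : Bool → Fin n
  rowStart true  = fromℕ< (>-nonZero⁻¹ n)
  rowStart false = fromℕ< h<n

  row-decomposition : ∀ y → Σ Bool λ b → Σ ℕ λ i → i < h × iterate next (rowStart b) i ≡ y
  row-decomposition y with toℕ y <? h
  ... | yes y<h = true , toℕ y , y<h , toℕ-≈-injective (begin
    toℕ (iterate next (rowStart true) (toℕ y))    ≈⟨ toℕ-next^ (toℕ y) (rowStart true) ⟩
    toℕ (rowStart true) + toℕ y                   ≡⟨ cong (_+ toℕ y) (toℕ-fromℕ< _) ⟩
    toℕ y                                         ∎)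
    where open ≈-Reasoning
  ... | no y≮h = false , toℕ y ∸ h , y∸h<h , toℕ-≈-injective (begin
    toℕ (iterate next (rowStart false) (toℕ y ∸ h))  ≈⟨ toℕ-next^ (toℕ y ∸ h) (rowStart false) ⟩
    toℕ (rowStart false) + (toℕ y ∸ h)               ≡⟨ cong (_+ (toℕ y ∸ h)) (toℕ-fromℕ< h<n) ⟩
    h + (toℕ y ∸ h)                                  ≡⟨ m+[n∸m]≡n h≤y ⟩
    toℕ y                                            ∎)
    where
    open ≈-Reasoning
    h≤y : h ≤ toℕ y
    h≤y = ≮⇒≥ y≮h
    y∸h<h : toℕ y ∸ h < h
    y∸h<h = ≤-trans (∸-monoˡ-< (toℕ<n y) h≤y) (≤-reflexive (m+n∸m≡n h h))

  stairIndices : List (Fin n × Bool)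
  stairIndices = cartesianProduct (allFin n) (true ∷ false ∷ [])

  ∈-stairIndices : ∀ w → w ∈ stairIndices
  ∈-stairIndices (a , true)  = ∈-cartesianProduct⁺ (∈-allFin a) (here refl)
  ∈-stairIndices (a , false) = ∈-cartesianProduct⁺ (∈-allFin a) (there (here refl))

  length-stairIndices : length stairIndices ≡ n * 2
  length-stairIndices = trans (length-cartesianProduct (allFin n) _) (cong (_* 2) (length-allFin n))

  stairEdges : Fin n × Bool → List (V G × V G)
  stairEdges (a , b) = edgesOf G (stair h a (rowStart b))

  stairs-cover-right : ∀ x y → Σ (Fin n × Bool) λ w → Any (SameEdge G ((x , y) , (next x , y))) (stairEdges w)
  stairs-cover-right x y with row-decomposition y
  ... | b , i , i<h , refl with next^-surjective (<⇒≤ (<-trans i<h h<n)) x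
  ...   | a , refl = (a , b) , stair-right i<h a (rowStart b)

  stairs-cover-up : ∀ x y → Σ (Fin n × Bool) λ w → Any (SameEdge G ((x , y) , (x , next y))) (stairEdges w)
  stairs-cover-up x y with row-decomposition y
  ... | b , i , i<h , refl with next^-surjective (≤-trans i<h (<⇒≤ h<n)) x
  ...   | a , refl = (a , b) , stair-up i<h a (rowStart b)

  stairs-cover : ∀ e → Adj G (proj₁ e) (proj₂ e) →
                 Σ (Fin n × Bool) λ w → w ∈ stairIndices × Any (SameEdge G e) (stairEdges w)
  stairs-cover ((x , y) , (x' , y')) adj = let (w , hit) = covering adj in w , ∈-stairIndices w , hit
    where
    flip : ∀ {e u v} → Any (SameEdge G (u , v)) e → Any (SameEdge G (v , u)) e
    flip = Any.map (SameEdge-trans (inj₂ (refl , refl)))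
    covering : Adj G (x , y) (x' , y') → Σ (Fin n × Bool) λ w → Any (SameEdge G ((x , y) , (x' , y'))) (stairEdges w)
    covering (inj₁ (a , refl)) with adj⇒next a
    ... | inj₁ refl = stairs-cover-right x y
    ... | inj₂ refl = let (w , hit) = stairs-cover-right x' y in w , flip hit
    covering (inj₂ (refl , a)) with adj⇒next a
    ... | inj₁ refl = stairs-cover-up x y
    ... | inj₂ refl = let (w , hit) = stairs-cover-up x y' in w , flip hit

  edgeGP-≤ : ∀ k S → IsEdgeGPSet G k S → length S ≤ n * 2 * (k ∸ 1)
  edgeGP-≤ k S ((adjs , _) , gp) = begin
    length S                                                    ≤⟨ length-≤-sum-countIn stairIndices stairEdges stairs-cover S adjs ⟩
    sum (map (λ w → countIn G S (stairEdges w)) stairIndices)   ≤⟨ sum-map-≤-length* stairIndices stair-bound ⟩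
    length stairIndices * (k ∸ 1)                               ≡⟨ cong (_* (k ∸ 1)) length-stairIndices ⟩
    n * 2 * (k ∸ 1)                                             ∎
    where
    open ≤-Reasoning
    stair-bound : ∀ w → countIn G S (stairEdges w) ≤ k ∸ 1
    stair-bound (a , b) = gp (stair h a (rowStart b)) (stair-geodesic a (rowStart b))

module MarkedColumns (T m : ℕ) {{_ : NonZero m}} (2≤h : 2 ≤ T * m) where

  open Torus (T * m) 2≤h public

  ⌈_/m⌉ : ℕ → ℕ
  ⌈ Z /m⌉ = (Z + pred m) / m

  ⌈⌉-mono : ∀ {Z Z'} → Z ≤ Z' → ⌈ Z /m⌉ ≤ ⌈ Z' /m⌉
  ⌈⌉-mono Z≤Z' = /-monoˡ-≤ m (+-monoˡ-≤ (pred m) Z≤Z')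

  ⌈⌉-+-* : ∀ Z k → ⌈ Z + k * m /m⌉ ≡ ⌈ Z /m⌉ + k
  ⌈⌉-+-* Z k = begin
    (Z + k * m + pred m) / m       ≡⟨ cong (_/ m) (xy∙z≈xz∙y Z (k * m) (pred m)) ⟩
    (Z + pred m + k * m) / m       ≡⟨ +-distrib-/-∣ʳ (Z + pred m) (n∣m*n k) ⟩
    ⌈ Z /m⌉ + k * m / m            ≡⟨ cong (⌈ Z /m⌉ +_) (m*n/n≡m k m) ⟩
    ⌈ Z /m⌉ + k                    ∎
    where open ≡-Reasoning

  ⌈⌉-suc-divisible : ∀ {Z} → Z % m ≡ 0 → suc ⌈ Z /m⌉ ≡ ⌈ suc Z /m⌉
  ⌈⌉-suc-divisible {Z} Z%m≡0 = begin
    suc ⌈ Z /m⌉                   ≡⟨ cong (λ z → suc ⌈ z /m⌉) Z≡q*m ⟩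
    suc ⌈ 0 + q * m /m⌉           ≡⟨ cong suc (⌈⌉-+-* 0 q) ⟩
    suc (⌈ 0 /m⌉ + q)             ≡⟨ cong (λ z → suc (z + q)) (m<n⇒m/n≡0 (≤-reflexive (suc-pred m))) ⟩
    suc q                         ≡⟨ cong (_+ q) (n/n≡1 m) ⟨
    m / m + q                     ≡⟨ cong (λ z → z / m + q) (suc-pred m) ⟨
    ⌈ 1 /m⌉ + q                   ≡⟨ ⌈⌉-+-* 1 q ⟨
    ⌈ 1 + q * m /m⌉               ≡⟨ cong (λ z → ⌈ suc z /m⌉) Z≡q*m ⟨
    ⌈ suc Z /m⌉                   ∎
    where
    open ≡-Reasoning
    q : ℕ
    q = Z / m
    Z≡q*m : Z ≡ q * m
    Z≡q*m = trans (m≡m%n+[m/n]*n Z m) (cong (_+ q * m) Z%m≡0)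

  m∣n : m ∣ n
  m∣n = divides (T + T) (sym (*-distribʳ-+ m T T))

  ≈⇒%m : ∀ {a b} → a ≈ b → a % m ≡ b % m
  ≈⇒%m {a} {b} eq = begin
    a % m          ≡⟨ m∣n⇒o%n%m≡o%m m n a m∣n ⟨
    a % n % m      ≡⟨ cong (_% m) eq ⟩
    b % n % m      ≡⟨ m∣n⇒o%n%m≡o%m m n b m∣n ⟩
    b % m          ∎
    where open ≡-Reasoning

  column : Fin (T + T) → Fin n
  column j = fromℕ< (subst (toℕ j * m <_) (*-distribʳ-+ m T T) (*-monoˡ-< m (toℕ<n j)))

  toℕ-column : ∀ j → toℕ (column j) ≡ toℕ j * m
  toℕ-column j = toℕ-fromℕ< _

  markedEdge : Fin (T + T) × Fin n → V G × V G
  markedEdge (j , z) = ((column j , z) , (next (column j) , z))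

  marked : List (V G × V G)
  marked = map markedEdge (cartesianProduct (allFin (T + T)) (allFin n))

  length-marked : length marked ≡ n * 2 * T
  length-marked = begin
    length marked                                          ≡⟨ length-map markedEdge (cartesianProduct (allFin (T + T)) (allFin n)) ⟩
    length (cartesianProduct (allFin (T + T)) (allFin n))  ≡⟨ length-cartesianProduct (allFin (T + T)) (allFin n) ⟩
    length (allFin (T + T)) * length (allFin n)            ≡⟨ cong₂ _*_ (length-allFin (T + T)) (length-allFin n) ⟩
    (T + T) * n                                            ≡⟨ rearrange T n ⟩
    n * 2 * T                                              ∎
    where
    open ≡-Reasoning
    rearrange : ∀ t k → (t + t) * k ≡ k * 2 * t
    rearrange = solve-∀

  all-marked : ∀ {P : V G × V G → Set} → (∀ p → P (markedEdge p)) → All P marked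
  all-marked P-marked = All.map⁺ (All.universal P-marked _)

  markedEdge-injective : ∀ {p q} → SameEdge G (markedEdge p) (markedEdge q) → p ≡ q
  markedEdge-injective {j , z} {j' , z'} (inj₁ (e₁ , _)) = cong₂ _,_ (toℕ-injective (*-cancelʳ-≡ (toℕ j) (toℕ j') m (begin
    toℕ j * m               ≡⟨ toℕ-column j ⟨
    toℕ (column j)          ≡⟨ cong (toℕ ∘ proj₁) e₁ ⟩
    toℕ (column j')         ≡⟨ toℕ-column j' ⟩
    toℕ j' * m              ∎)))
    (cong proj₂ e₁)
    where open ≡-Reasoning
  markedEdge-injective {j , z} {j' , z'} (inj₂ (e₁ , e₂)) =
    contradiction (trans (cong (next ∘ proj₁) (sym e₁)) (cong proj₁ e₂)) (next^-≢ {2} (s≤s z≤n) 2<n (column j'))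

  marked-distinct : AllPairs (λ e e' → ¬ SameEdge G e e') marked
  marked-distinct = AllPairs.map⁺ (AllPairs.map (λ p≢q same → p≢q (markedEdge-injective same))
                      (Unique.cartesianProduct⁺ (Unique.allFin⁺ (T + T)) (Unique.allFin⁺ n)))

  marked-adjacent : All (λ e → Adj G (proj₁ e) (proj₂ e)) marked
  marked-adjacent = all-marked λ { (j , z) → inj₁ (adj-next (column j) , refl) }

  column-marked : ∀ j → toℕ (column j) % m ≡ 0
  column-marked j = trans (cong (_% m) (toℕ-column j)) (m*n%n≡0 (toℕ j) m)

  count-horizontal : ∀ Z {x y f} → Z ≈ toℕ x → SameEdge G f ((x , y) , (next x , y)) →
                     countIn G marked [ f ] + ⌈ Z /m⌉ ≤ ⌈ suc Z /m⌉
  count-horizontal Z {x} {y} {f} Z≈x f~ with toℕ x % m ≟ 0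
  ... | yes x-marked = begin
    countIn G marked [ f ] + ⌈ Z /m⌉   ≤⟨ +-monoˡ-≤ ⌈ Z /m⌉ (countIn-[-]≤1 marked f marked-distinct) ⟩
    suc ⌈ Z /m⌉                        ≡⟨ ⌈⌉-suc-divisible (trans (≈⇒%m Z≈x) x-marked) ⟩
    ⌈ suc Z /m⌉                        ∎
    where open ≤-Reasoning
  ... | no x-unmarked = begin
    countIn G marked [ f ] + ⌈ Z /m⌉   ≡⟨ cong (_+ ⌈ Z /m⌉) (countIn-[-]≡0 marked f (all-marked other)) ⟩
    ⌈ Z /m⌉                            ≤⟨ ⌈⌉-mono (n≤1+n Z) ⟩
    ⌈ suc Z /m⌉                        ∎
    where
    open ≤-Reasoning
    other : ∀ p → ¬ SameEdge G (markedEdge p) f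
    other (j , z) same with SameEdge-trans same f~
    ... | inj₁ (e₁ , _)  = x-unmarked (subst (λ w → toℕ w % m ≡ 0) (cong proj₁ e₁) (column-marked j))
    ... | inj₂ (e₁ , e₂) = next^-≢ {2} (s≤s z≤n) 2<n x (trans (cong (next ∘ proj₁) (sym e₁)) (cong proj₁ e₂))

  count-vertical : ∀ x {y y'} → Adj C y y' → ∀ F →
                   countIn G marked (((x , y) , (x , y')) ∷ F) ≤ countIn G marked F
  count-vertical x {y} {y'} adj F = begin
    countIn G marked (e ∷ F)                        ≤⟨ countIn-∷ʳ marked e F ⟩
    countIn G marked [ e ] + countIn G marked F     ≡⟨ cong (_+ countIn G marked F) (countIn-[-]≡0 marked e (all-marked other)) ⟩
    countIn G marked F                              ∎
    where
    open ≤-Reasoning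
    e : V G × V G
    e = ((x , y) , (x , y'))
    y≢y' : y ≢ y'
    y≢y' refl with adj⇒next adj
    ... | inj₁ e = next^-≢ {1} (s≤s z≤n) 1<n y (sym e)
    ... | inj₂ e = next^-≢ {1} (s≤s z≤n) 1<n y (sym e)
    other : ∀ p → ¬ SameEdge G (markedEdge p) e
    other p (inj₁ (e₁ , e₂)) = y≢y' (trans (sym (cong proj₂ e₁)) (cong proj₂ e₂))
    other p (inj₂ (e₁ , e₂)) = y≢y' (trans (sym (cong proj₂ e₂)) (cong proj₂ e₁))

  rightward-count : ∀ {x y v} (P : Walk G (x , y) v) → left P ≡ 0 → ∀ Z → Z ≈ toℕ x →
                    countIn G marked (edgesOf G P) + ⌈ Z /m⌉ ≤ ⌈ Z + right P /m⌉
  rightward-count [] _ Z _ = ≤-reflexive (cong₂ _+_ (countIn-[]ʳ marked) (cong ⌈_/m⌉ (sym (+-identityʳ Z))))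
  rightward-count {x} {y} (inj₁ (a , refl) ∷ p) left≡0 Z Z≈x with adj⇒next a
  ... | inj₁ refl = begin
    countIn G marked (e ∷ edgesOf G p) + ⌈ Z /m⌉                          ≤⟨ +-monoˡ-≤ _ (countIn-∷ʳ marked e _) ⟩
    countIn G marked [ e ] + countIn G marked (edgesOf G p) + ⌈ Z /m⌉     ≡⟨ xy∙z≈y∙xz (countIn G marked [ e ]) _ _ ⟩
    countIn G marked (edgesOf G p) + (countIn G marked [ e ] + ⌈ Z /m⌉)   ≤⟨ +-monoʳ-≤ _ (count-horizontal Z Z≈x (inj₁ (refl , refl))) ⟩
    countIn G marked (edgesOf G p) + ⌈ suc Z /m⌉                          ≤⟨ rightward-count p left≡0 (suc Z) (trans (+-congˡ-≈ 1 Z≈x) (sym (toℕ-next x))) ⟩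
    ⌈ suc Z + right p /m⌉                                                 ≡⟨ cong ⌈_/m⌉ (+-suc Z (right p)) ⟨
    ⌈ Z + suc (right p) /m⌉                                               ∎
    where
    open ≤-Reasoning
    e : V G × V G
    e = ((x , y) , (next x , y))
  ... | inj₂ _ = contradiction left≡0 λ ()
  rightward-count {x} (inj₂ (refl , a) ∷ p) left≡0 Z Z≈x =
    ≤-trans (+-monoˡ-≤ ⌈ Z /m⌉ (count-vertical x a (edgesOf G p))) (rightward-count p left≡0 Z Z≈x)

  leftward-count : ∀ {x y v} (P : Walk G (x , y) v) → right P ≡ 0 → ∀ W → W + left P ≈ toℕ x →
                   countIn G marked (edgesOf G P) + ⌈ W /m⌉ ≤ ⌈ W + left P /m⌉
  leftward-count [] _ W _ = ≤-reflexive (cong₂ _+_ (countIn-[]ʳ marked) (cong ⌈_/m⌉ (sym (+-identityʳ W))))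
  leftward-count {y = y} (_∷_ {v = x' , _} (inj₁ (a , refl)) p) right≡0 W W+l≈x with adj⇒next a
  ... | inj₁ _ = contradiction right≡0 λ ()
  ... | inj₂ refl = begin
    countIn G marked (e ∷ edgesOf G p) + ⌈ W /m⌉                          ≤⟨ +-monoˡ-≤ _ (countIn-∷ʳ marked e _) ⟩
    countIn G marked [ e ] + countIn G marked (edgesOf G p) + ⌈ W /m⌉     ≡⟨ +-assoc (countIn G marked [ e ]) _ _ ⟩
    countIn G marked [ e ] + (countIn G marked (edgesOf G p) + ⌈ W /m⌉)   ≤⟨ +-monoʳ-≤ _ (leftward-count p right≡0 W W+l≈x') ⟩
    countIn G marked [ e ] + ⌈ W + left p /m⌉                             ≤⟨ count-horizontal (W + left p) W+l≈x' (inj₂ (refl , refl)) ⟩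
    ⌈ suc (W + left p) /m⌉                                                ≡⟨ cong ⌈_/m⌉ (+-suc W (left p)) ⟨
    ⌈ W + suc (left p) /m⌉                                                ∎
    where
    open ≤-Reasoning
    e : V G × V G
    e = ((next x' , y) , (x' , y))
    W+l≈x' : W + left p ≈ toℕ x'
    W+l≈x' = suc-cancel-≈ (trans (subst (_≈ toℕ (next x')) (+-suc W (left p)) W+l≈x) (toℕ-next x'))
  leftward-count {x} (inj₂ (refl , a) ∷ p) right≡0 W W+l≈x =
    ≤-trans (+-monoˡ-≤ ⌈ W /m⌉ (count-vertical x a (edgesOf G p))) (leftward-count p right≡0 W W+l≈x)

  count-≤-T : ∀ {c W k} → k ≤ T * m → c + ⌈ W /m⌉ ≤ ⌈ W + k /m⌉ → c ≤ T
  count-≤-T {c} {W} {k} k≤h bound = +-cancelʳ-≤ ⌈ W /m⌉ c T (begin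
    c + ⌈ W /m⌉           ≤⟨ bound ⟩
    ⌈ W + k /m⌉           ≤⟨ ⌈⌉-mono (+-monoʳ-≤ W k≤h) ⟩
    ⌈ W + T * m /m⌉       ≡⟨ ⌈⌉-+-* W T ⟩
    ⌈ W /m⌉ + T           ≡⟨ +-comm ⌈ W /m⌉ T ⟩
    T + ⌈ W /m⌉           ∎)
    where open ≤-Reasoning

  geodesic-count : ∀ {u v} (P : Walk G u v) → Geodesic G P → countIn G marked (edgesOf G P) ≤ T
  geodesic-count {x , _} P geo = [ rightward , leftward ]′ (geodesic-monotone P geo)
    where
    horizontal≤h : right P + left P ≤ T * m
    horizontal≤h = geodesic-horizontal-≤h P geo
    rightward : left P ≡ 0 → countIn G marked (edgesOf G P) ≤ T
    rightward left≡0 = count-≤-T {W = toℕ x} {k = right P} (≤-trans (m≤m+n (right P) (left P)) horizontal≤h)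
                                 (rightward-count P left≡0 (toℕ x) refl)
    leftward : right P ≡ 0 → countIn G marked (edgesOf G P) ≤ T
    leftward right≡0 = count-≤-T {W = W} {k = left P} left≤h (leftward-count P right≡0 W W+l≈x)
      where
      left≤h : left P ≤ T * m
      left≤h = ≤-trans (m≤n+m (left P) (right P)) horizontal≤h
      W : ℕ
      W = toℕ x + (n ∸ left P)
      W+l≈x : W + left P ≈ toℕ x
      W+l≈x = begin
        toℕ x + (n ∸ left P) + left P    ≡⟨ +-assoc (toℕ x) (n ∸ left P) (left P) ⟩
        toℕ x + (n ∸ left P + left P)    ≡⟨ cong (toℕ x +_) (m∸n+n≡m (≤-trans left≤h (<⇒≤ h<n))) ⟩
        toℕ x + n                        ≈⟨ +n-≈ (toℕ x) ⟩
        toℕ x                            ∎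
        where open ≈-Reasoning

  marked-edgeGP : IsEdgeGPSet G (T + 1) marked
  marked-edgeGP = (marked-adjacent , marked-distinct)
                , λ P geo → subst (countIn G marked (edgesOf G P) ≤_) (sym (m+n∸n≡m T 1)) (geodesic-count P geo)

edgeGPNumber-torus : ∀ T m {{_ : NonZero m}} → 2 ≤ T * m →
  EdgeGPNumber (Cycle (T * m + T * m) □ Cycle (T * m + T * m)) (T + 1) ((T * m + T * m) * 2 * T)
edgeGPNumber-torus T m 2≤h =
    (marked , marked-edgeGP , length-marked)
  , λ S gp → subst (length S ≤_) (cong (n * 2 *_) (m+n∸n≡m T 1)) (edgeGP-≤ (T + 1) S gp)
  where open MarkedColumns T m 2≤h

theorem3p3 : ∀ (r t : ℕ) → 3 ≤ r → 1 ≤ t → 2 ^ t ≤ 2 ^ (r ∸ 1) ∸ 2 →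
    EdgeGPNumber (Cycle (2 ^ r) □ Cycle (2 ^ r)) (2 ^ t + 1) (2 ^ (r + t + 1))
theorem3p3 (suc r) t (s≤s 2≤r) _ 2^t≤2^r∸2 =
  subst₂ (λ N k → EdgeGPNumber (Cycle N □ Cycle N) (2 ^ t + 1) k) n≡2^[1+r] size≡
         (edgeGPNumber-torus T M {{m^n≢0 2 (r ∸ t)}} 2≤h)
  where
  T M : ℕ
  T = 2 ^ t
  M = 2 ^ (r ∸ t)
  t≤r : t ≤ r
  t≤r = ≮⇒≥ λ r<t → <⇒≱ (^-monoʳ-< 2 (s≤s (s≤s z≤n)) r<t) (≤-trans 2^t≤2^r∸2 (m∸n≤m (2 ^ r) 2))
  h≡2^r : T * M ≡ 2 ^ r
  h≡2^r = trans (sym (^-distribˡ-+-* 2 t (r ∸ t))) (cong (2 ^_) (m+[n∸m]≡n t≤r))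
  2≤h : 2 ≤ T * M
  2≤h = subst (2 ≤_) (sym h≡2^r) (^-monoʳ-≤ 2 (≤-trans (s≤s z≤n) 2≤r))
  n≡2^[1+r] : T * M + T * M ≡ 2 ^ suc r
  n≡2^[1+r] = trans (cong (λ k → k + k) h≡2^r) (cong (2 ^ r +_) (sym (+-identityʳ (2 ^ r))))
  size≡ : (T * M + T * M) * 2 * T ≡ 2 ^ (suc r + t + 1)
  size≡ = begin
    (T * M + T * M) * 2 * T          ≡⟨ cong (λ k → k * 2 * T) n≡2^[1+r] ⟩
    2 ^ suc r * 2 * 2 ^ t            ≡⟨ rearrange (2 ^ suc r) (2 ^ t) ⟩
    2 ^ suc r * 2 ^ t * 2 ^ 1        ≡⟨ cong (_* 2 ^ 1) (^-distribˡ-+-* 2 (suc r) t) ⟨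
    2 ^ (suc r + t) * 2 ^ 1          ≡⟨ ^-distribˡ-+-* 2 (suc r + t) 1 ⟨
    2 ^ (suc r + t + 1)              ∎
    where
    open ≡-Reasoning
    rearrange : ∀ a b → a * 2 * b ≡ a * b * 2 ^ 1
    rearrange = solve-∀
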